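{- Let $A$ be a finite non-empty set of agents. For every agent $a\in A$ and every $\varphi\in\mathcal{L}_{KS}$, the formula $S_a\varphi\leftrightarrow K_aS_a\varphi$ is true at every facet of every simplicial secrecy model. Consequently $S_a\varphi\to K_aS_a\varphi$ and $\neg S_a\varphi\to K_a\neg S_a\varphi$ are true at every facet of every simplicial secrecy model.
   Context: A simplicial complex is a pair $(V,\mathcal{F})$ with $V$ a non-empty set and $\mathcal{F}$ a non-empty family of finite non-empty subsets of $V$ (faces), closed under non-empty subsets. A facet is an inclusion-maximal face; $\mathrm{Fac}$ denotes the set of facets. An $A$-chromatic simplicial complex is $(V,\mathcal{F},\chi)$ with $\chi:V\to A$ injective on every face. An $A$-chromatic simplicial epistemic model is $(V,\mathcal{F},\chi,\nu)$ where $(V,\mathcal{F},\chi)$ is $A$-chromatic, every facet $X$ satisfies $\chi[X]=A$, every vertex lies in some facet, and $\nu:\mathrm{Fac}\to\mathcal{P}(\mathsf{Prop})$ for a countable set $\mathsf{Prop}$. For a facet $X$ and $a\in A$, $v_a(X)$ is the unique vertex of colour $a$ in $X$; $\mathrm{St}(v)=\{X\in\mathrm{Fac}: v\in X\}$; $X\sim_a Y$ iff $v_a(X)=v_a(Y)$. A simplicial secrecy model is $M=(V,\mathcal{F},\chi,\nu,\{N^S_a\}_{a\in A})$ where $(V,\mathcal{F},\chi,\nu)$ is such a model and, with $V_a=\{v:\chi(v)=a\}$, each $N_a^S:V_a\to\mathcal{P}(\mathcal{P}(\mathrm{Fac}(M)))$ satisfies (SN): for every $a$, $v\in V_a$, $U\in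 N_a^S(v)$, every $X\in\mathrm{St}(v)$ and every $b\in A\setminus\{a\}$ there is a facet $Y$ with $X\sim_b Y$ and $Y\notin U$. The language $\mathcal{L}_{KS}$ is $\varphi::=p\mid\neg\varphi\mid(\varphi\wedge\varphi)\mid K_a\varphi\mid S_a\varphi$. Truth at facets: $M,X\Vdash p$ iff $p\in\nu(X)$; Boolean clauses as usual; $M,X\Vdash K_a\varphi$ iff $M,Y\Vdash\varphi$ for all $Y$ with $X\sim_a Y$; $M,X\Vdash S_a\varphi$ iff $M,X\Vdash K_a\varphi$ and $[\![\varphi]\!]\in N_a^S(v_a(X))$, where $[\![\varphi]\!]=\{Y\in\mathrm{Fac}(M):M,Y\Vdash\varphi\}$. -}

module Defs where

open import Level using (_⊔_) renaming (suc to lsuc; zero to lzero)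

open import Data.Nat using (ℕ; suc)
open import Data.Fin using (Fin)
open import Data.Bool using (Bool; true)
open import Data.List using (List)
open import Data.List.Membership.Propositional using (_∈_)
open import Data.Product using (Σ; ∃; _×_; _,_; proj₁; proj₂)
open import Relation.Nullary using (¬_)
open import Relation.Binary.PropositionalEquality using (_≡_; _≢_)
open import Function.Definitions using (Injective)
open import Function.Bundles using (_↔_)

-- Subsets of a type are predicates.  Faces/facets (subsets of V) are
-- represented by characteristic functions V → Bool (classically P(V) ≅ 2^V),
-- so that the type of facets lives in Set.

Subset : ∀ {ℓ} → Set ℓ → Set (lsuc lzero ⊔ ℓ)
Subset V = V → Set

VSet : Set → Set
VSet V = V → Bool

_∋_ : {V : Set} → VSet V → V → Set
X ∋ v = X v ≡ true

_⊆_ : {V : Set} → VSet V → VSet V → Set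
X ⊆ Y = ∀ v → X ∋ v → Y ∋ v

NonEmpty : {V : Set} → VSet V → Set
NonEmpty {V} X = Σ V λ v → X ∋ v

FiniteSubset : {V : Set} → VSet V → Set
FiniteSubset {V} X = Σ (List V) λ l → ∀ v → X ∋ v → v ∈ l

FiniteNonEmpty : Set → Set
FiniteNonEmpty A = Σ ℕ λ n → A ↔ Fin (suc n)

Countable : Set → Set
Countable P = Σ (P → ℕ) λ f → Injective _≡_ _≡_ f

record EpistemicModel (A : Set) (Prop : Set) : Set₁ where
  field
    V           : Set
    V-nonempty  : V
    IsFace      : VSet V → Set
    face-finite : ∀ X → IsFace X → FiniteSubset X
    face-ne     : ∀ X → IsFace X → NonEmpty X
    F-ne        : Σ (VSet V) IsFace
    down-closed : ∀ X Y → IsFace X → Y ⊆ X → NonEmpty Y → IsFace Y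

  IsFacet : VSet V → Set
  IsFacet X = IsFace X × (∀ Y → IsFace Y → X ⊆ Y → Y ⊆ X)

  Fac : Set
  Fac = Σ (VSet V) IsFacet

  field
    χ            : V → A
    χ-inj        : ∀ X → IsFace X → ∀ u v → X ∋ u → X ∋ v → χ u ≡ χ v → u ≡ v
    facet-colour : (X : Fac) → (a : A) → Σ V λ v → proj₁ X ∋ v × χ v ≡ a
    vertex-facet : (v : V) → Σ Fac λ X → proj₁ X ∋ v
    Prop-countable : Countable Prop
    ν            : Fac → Subset Prop

  -- v_a(X): the (unique, by χ-inj) vertex of colour a in X
  vtx : A → Fac → V
  vtx a X = proj₁ (facet-colour X a)

  vtx-col : (a : A) → (X : Fac) → χ (vtx a X) ≡ a
  vtx-col a X = proj₂ (proj₂ (facet-colour X a))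

  St : V → Subset Fac
  St v X = proj₁ X ∋ v

  _∼[_]_ : Fac → A → Fac → Set
  X ∼[ a ] Y = vtx a X ≡ vtx a Y

  V[_] : A → Set
  V[ a ] = Σ V λ v → χ v ≡ a

record SecrecyModel (A : Set) (Prop : Set) : Set₂ where
  field
    base : EpistemicModel A Prop
  open EpistemicModel base public
  field
    N  : (a : A) → V[ a ] → Subset (Subset Fac)
    SN : ∀ a (v : V[ a ]) (U : Subset Fac) → N a v U →
         ∀ (X : Fac) → St (proj₁ v) X →
         ∀ b → b ≢ a → Σ Fac λ Y → (X ∼[ b ] Y) × ¬ U Y

data Form (A : Set) (Prop : Set) : Set where
  atom : Prop → Form A Prop
  ¬'_  : Form A Prop → Form A Prop
  _∧'_ : Form A Prop → Form A Prop → Form A Prop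
  K    : A → Form A Prop → Form A Prop
  S    : A → Form A Prop → Form A Prop

_⇒'_ : ∀ {A Prop} → Form A Prop → Form A Prop → Form A Prop
φ ⇒' ψ = ¬' (φ ∧' (¬' ψ))

_⇔'_ : ∀ {A Prop} → Form A Prop → Form A Prop → Form A Prop
φ ⇔' ψ = (φ ⇒' ψ) ∧' (ψ ⇒' φ)

module _ {A Prop : Set} (M : SecrecyModel A Prop) where
  open SecrecyModel M

  _⊩_ : Fac → Form A Prop → Set
  X ⊩ atom p  = ν X p
  X ⊩ (¬' φ)  = ¬ (X ⊩ φ)
  X ⊩ (φ ∧' ψ) = (X ⊩ φ) × (X ⊩ ψ)
  X ⊩ K a φ   = ∀ Y → X ∼[ a ] Y → Y ⊩ φ
  X ⊩ S a φ   = (∀ Y → X ∼[ a ] Y → Y ⊩ φ) × N a (vtx a X , vtx-col a X) (λ Y → Y ⊩ φ)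

  ⟦_⟧ : Form A Prop → Subset Fac
  ⟦ φ ⟧ Y = Y ⊩ φ

-- S_a φ holds at X exactly when K_a φ holds there and ⟦φ⟧ is in the
-- neighbourhood of v_a(X); both conditions depend on X only through its
-- a-coloured vertex.  A formula with that property is known to a exactly when
-- it holds, and so is its negation, since ∼_a is an equivalence relation.
module Submission where

open import Defs
open import Data.Product using (_×_; _,_)
open import Relation.Binary.PropositionalEquality using (_≡_; refl; sym; trans)

module _ {A Prop : Set} (M : SecrecyModel A Prop) where
  open SecrecyModel M

  ⇒'-intro : ∀ {X} φ ψ → (_⊩_ M X φ → _⊩_ M X ψ) → _⊩_ M X (φ ⇒' ψ)
  ⇒'-intro _ _ f (p , ¬q) = ¬q (f p)

  K-reflexive : ∀ {X} a φ → _⊩_ M X (K a φ) → _⊩_ M X φ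
  K-reflexive {X} _ _ k = k X refl

  Invariant : A → Form A Prop → Set
  Invariant a φ = ∀ X Y → X ∼[ a ] Y → _⊩_ M X φ → _⊩_ M Y φ

  invariant⇒positive-introspection : ∀ a φ → Invariant a φ →
    ∀ X → _⊩_ M X φ → _⊩_ M X (K a φ)
  invariant⇒positive-introspection _ _ inv X p Y X∼Y = inv X Y X∼Y p

  invariant⇒negative-introspection : ∀ a φ → Invariant a φ →
    ∀ X → _⊩_ M X (¬' φ) → _⊩_ M X (K a (¬' φ))
  invariant⇒negative-introspection _ _ inv X ¬p Y X∼Y q = ¬p (inv Y X (sym X∼Y) q)

  subst-V[] : ∀ {a} (P : V[ a ] → Set) {v w : V} (v∈Va : χ v ≡ a) (w∈Va : χ w ≡ a) →
    v ≡ w → P (v , v∈Va) → P (w , w∈Va)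
  subst-V[] P refl refl refl p = p

  S-invariant : ∀ a φ → Invariant a (S a φ)
  S-invariant a φ X Y X∼Y (k , n) =
    (λ Z Y∼Z → k Z (trans X∼Y Y∼Z)) ,
    subst-V[] (λ v → N a v (⟦_⟧ M φ)) (vtx-col a X) (vtx-col a Y) X∼Y n

proposition5p2 : (A : Set) → FiniteNonEmpty A → (Prop : Set) →
    (M : SecrecyModel A Prop) → (a : A) → (φ : Form A Prop) →
    (X : SecrecyModel.Fac M) →
    _⊩_ M X (S a φ ⇔' K a (S a φ))
    × _⊩_ M X (S a φ ⇒' K a (S a φ))
    × _⊩_ M X ((¬' S a φ) ⇒' K a (¬' S a φ))
proposition5p2 A _ Prop M a φ X =
  (S⇒KS , ⇒'-intro M (K a (S a φ)) (S a φ) (K-reflexive M a (S a φ))) , S⇒KS , ¬S⇒K¬S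
  where
  S⇒KS : _⊩_ M X (S a φ ⇒' K a (S a φ))
  S⇒KS = ⇒'-intro M (S a φ) (K a (S a φ))
    (invariant⇒positive-introspection M a (S a φ) (S-invariant M a φ) X)

  ¬S⇒K¬S : _⊩_ M X ((¬' S a φ) ⇒' K a (¬' S a φ))
  ¬S⇒K¬S = ⇒'-intro M (¬' S a φ) (K a (¬' S a φ))
    (invariant⇒negative-introspection M a (S a φ) (S-invariant M a φ) X)
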